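{- Let $K$ be an integer and $m,n>1$ integers, and assume either that $K$ is odd, or that $K$ is even and $m,n$ are both odd. Let $L=\mathrm{lcm}[m,n]$. Then: (a) if $\omega_K(m)=\omega_K(n)=1$, then $\omega_K(L)=1$; (b) if $\omega_K(m)=2$ or $\omega_K(n)=2$, then $\omega_K(L)=2$; (c) if $\omega_K(m)=\omega_K(n)=4$, then $\omega_K(L)=4$; (d) if one of $m,n$ has order $1$ and the other has order $4$, then $\omega_K(L)=4$ if the one of order $1$ equals $2$, and $\omega_K(L)=2$ otherwise.
   Context: For an integer $K$, the $K$-Fibonacci sequence is $F_{K,0}=0$, $F_{K,1}=1$, $F_{K,n}=KF_{K,n-1}+F_{K,n-2}$ for $n\ge2$. For an integer $m\ge 2$, $\pi_K(m)$ is the least positive period of $(F_{K,n}\bmod m)$ and $\omega_K(m)$ (the order of $m$) is the number of indices $0\le j<\pi_K(m)$ with $m\mid F_{K,j}$. -}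

module Defs where

open import Data.Nat as ℕ using (ℕ; zero; suc; _≤_; _<_)
open import Data.Integer as ℤ using (ℤ; +_)
open import Data.Integer.Divisibility.Signed using (_∣_; _∣?_)
open import Data.List using (List; length; filter; upTo)
open import Data.Product using (_×_; ∃-syntax)
open import Relation.Binary.PropositionalEquality using (_≡_)
open import Relation.Nullary using (¬_)

F : ℤ → ℕ → ℤ
F K zero = + 0
F K (suc zero) = + 1
F K (suc (suc n)) = K ℤ.* F K (suc n) ℤ.+ F K n

IsPeriod : ℤ → ℕ → ℕ → Set
IsPeriod K m p = 0 < p × (∀ n → (+ m) ∣ (F K (n ℕ.+ p) ℤ.- F K n))

IsPisanoPeriod : ℤ → ℕ → ℕ → Set
IsPisanoPeriod K m p = IsPeriod K m p × (∀ q → IsPeriod K m q → p ≤ q)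

zeroCount : ℤ → ℕ → ℕ → ℕ
zeroCount K m p = length (filter (λ j → (+ m) ∣? F K j) (upTo p))

HasOrder : ℤ → ℕ → ℕ → Set
HasOrder K m k = ∃[ p ] (IsPisanoPeriod K m p × zeroCount K m p ≡ k)

OddInt : ℤ → Set
OddInt K = ¬ ((+ 2) ∣ K)

OddNat : ℕ → Set
OddNat n = ¬ ((+ 2) ∣ (+ n))

-- Let α be the rank of apparition of m (the least α > 0 with m ∣ F_α) and s = F_{α+1}. The
-- addition formula gives F_{n+α} ≡ s·F_n (mod m) and the Cassini identity gives s² ≡ (−1)^α, so
-- s⁴ ≡ 1 and s is a unit mod m. Hence the zeros of F mod m are exactly the multiples of α, the
-- period is α·ord_m(s), and ω(m) = ord_m(s) ∈ {1, 2, 4}.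
--
-- For L = lcm(m, n) we have α(L) = a·α(m) = b·α(n) with a, b not both even, and s_L ≡ s_m^a
-- (mod m), s_L ≡ s_n^b (mod n). Each case is then a parity count on a, b, α(m), α(n), using:
-- ω(m) = 2 forces α(m) even; ω(m) = 1 forces α(m) even unless m = 2, where α = 3; and
-- ω(m) = 1 forces 4 ∤ α(m). The last fact is where K or m must be odd: if α = 2k with k even,
-- the doubling formulas and the Cassini identity give m ∣ 2F_k and m ∣ K·F_k, hence m ∣ F_k.

{-# OPTIONS --safe #-}
module Submission where

open import Defs
open import Data.Nat as ℕ
  using (ℕ; zero; suc; z≤n; s≤s; z<s; _<_; _≤_; _<?_; NonZero; >-nonZero)
import Data.Nat.Properties as ℕ
open import Data.Nat.Divisibility as ℕ using () renaming (_∣_ to _∣ℕ_)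
open import Data.Nat.DivMod using (_%_; _/_; m%n<n; m≡m%n+[m/n]*n)
open import Data.Nat.Induction using (<-rec)
open import Data.Nat.Primality using (euclidsLemma; prime[2])
open import Data.Nat.LCM using (lcm; lcm-least; lcm-comm; m∣lcm[m,n]; n∣lcm[m,n])
open import Data.Integer as ℤ using (ℤ; +_; 0ℤ; 1ℤ; -1ℤ; _+_; _-_; -_; _*_; _^_)
import Data.Integer.Properties as ℤ
open import Data.Integer.DivMod using (_%ℕ_; _/ℕ_; n%ℕd<d; a≡a%ℕn+[a/ℕn]*n)
open import Data.Integer.Divisibility.Signed
  using (_∣_; divides; _∣?_; ∣ᵤ⇒∣; ∣⇒∣ᵤ; ∣-refl; ∣-trans;
         ∣m∣n⇒∣m+n; ∣m∣n⇒∣m-n; ∣m⇒∣-m; ∣n⇒∣m*n)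
open import Data.Integer.Tactic.RingSolver using (solve-∀)
import Data.Nat.Tactic.RingSolver as ℕ-Ring
open import Data.Product as Product using (_×_; _,_; proj₁; proj₂; ∃-syntax)
open import Data.Fin using (Fin; toℕ; fromℕ<; combine)
open import Data.List using (_++_; [_]; length; filter; upTo)
import Data.List.Properties as List
import Data.Fin.Properties as Fin
open import Data.Sum using (_⊎_; inj₁; inj₂; [_,_]′; map₂)
open import Data.Empty using (⊥)
open import Function using (_∘_; id)
open import Level using (0ℓ)
open import Relation.Binary.Bundles using (Setoid)
import Relation.Binary.Reasoning.Setoid as SetoidReasoning
open import Relation.Binary.PropositionalEquality
  using (_≡_; _≢_; refl; sym; trans; cong; cong₂; subst; module ≡-Reasoning)
open import Relation.Unary using (Pred; Decidable)
open import Relation.Nullary using (¬_; Dec; yes; no; contradiction)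
open import Relation.Nullary.Decidable using (map′; _×-dec_; decidable-stable; from-no)

private
  variable
    K x y u v : ℤ
    m n k : ℕ

-- Congruences modulo m

infix 4 _≡_mod_ _≡?_mod_

-- A record rather than a definition, so that x, y and m can be recovered from the type.
record _≡_mod_ (x y : ℤ) (m : ℕ) : Set where
  constructor ∣⇒≡-mod
  field ≡-mod⇒∣ : + m ∣ x - y
open _≡_mod_ public

≡⇒≡-mod : x ≡ y → x ≡ y mod m
≡⇒≡-mod {x = x} refl = ∣⇒≡-mod (subst (_ ∣_) (sym (ℤ.+-inverseʳ x)) (divides 0ℤ refl))

≡-mod-refl : x ≡ x mod m
≡-mod-refl = ≡⇒≡-mod refl

≡-mod-sym : x ≡ y mod m → y ≡ x mod m
≡-mod-sym {x = x} {y = y} (∣⇒≡-mod p) = ∣⇒≡-mod (subst (_ ∣_) (negate x y) (∣m⇒∣-m p))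
  where
  negate : ∀ x y → - (x - y) ≡ y - x
  negate = solve-∀

≡-mod-trans : x ≡ y mod m → y ≡ u mod m → x ≡ u mod m
≡-mod-trans {x = x} {y = y} {u = u} (∣⇒≡-mod p) (∣⇒≡-mod q) =
  ∣⇒≡-mod (subst (_ ∣_) (telescope x y u) (∣m∣n⇒∣m+n p q))
  where
  telescope : ∀ x y u → (x - y) + (y - u) ≡ x - u
  telescope = solve-∀

+-cong-mod : x ≡ y mod m → u ≡ v mod m → x + u ≡ y + v mod m
+-cong-mod {x = x} {y = y} {u = u} {v = v} (∣⇒≡-mod p) (∣⇒≡-mod q) =
  ∣⇒≡-mod (subst (_ ∣_) (split x y u v) (∣m∣n⇒∣m+n p q))
  where
  split : ∀ x y u v → (x - y) + (u - v) ≡ (x + u) - (y + v)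
  split = solve-∀

*-cong-mod : x ≡ y mod m → u ≡ v mod m → x * u ≡ y * v mod m
*-cong-mod {x = x} {y = y} {u = u} {v = v} (∣⇒≡-mod p) (∣⇒≡-mod q) =
  ∣⇒≡-mod (subst (_ ∣_) (split x y u v) (∣m∣n⇒∣m+n (∣n⇒∣m*n u p) (∣n⇒∣m*n y q)))
  where
  split : ∀ x y u v → u * (x - y) + y * (u - v) ≡ x * u - y * v
  split = solve-∀

+-congˡ-mod : ∀ u → x ≡ y mod m → u + x ≡ u + y mod m
+-congˡ-mod u = +-cong-mod (≡-mod-refl {x = u})

-‿cong-mod : x ≡ y mod m → - x ≡ - y mod m
-‿cong-mod {x = x} {y = y} (∣⇒≡-mod p) = ∣⇒≡-mod (subst (_ ∣_) (negate x y) (∣m⇒∣-m p))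
  where
  negate : ∀ x y → - (x - y) ≡ - x - - y
  negate = solve-∀

*-congˡ-mod : ∀ u → x ≡ y mod m → u * x ≡ u * y mod m
*-congˡ-mod u = *-cong-mod (≡-mod-refl {x = u})

*-congʳ-mod : ∀ u → x ≡ y mod m → x * u ≡ y * u mod m
*-congʳ-mod u x≡y = *-cong-mod x≡y (≡-mod-refl {x = u})

^-cong-mod : ∀ k → x ≡ y mod m → x ^ k ≡ y ^ k mod m
^-cong-mod zero    x≡y = ≡⇒≡-mod refl
^-cong-mod (suc k) x≡y = *-cong-mod x≡y (^-cong-mod k x≡y)

∣⇒≡0-mod : + m ∣ x → x ≡ 0ℤ mod m
∣⇒≡0-mod {x = x} m∣x = ∣⇒≡-mod (subst (_ ∣_) (sym (ℤ.+-identityʳ x)) m∣x)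

≡0-mod⇒∣ : x ≡ 0ℤ mod m → + m ∣ x
≡0-mod⇒∣ {x = x} (∣⇒≡-mod m∣x-0) = subst (_ ∣_) (ℤ.+-identityʳ x) m∣x-0

_≡?_mod_ : ∀ x y m → Dec (x ≡ y mod m)
x ≡? y mod m = map′ ∣⇒≡-mod ≡-mod⇒∣ (+ m ∣? x - y)

≡-mod-setoid : ℕ → Setoid 0ℓ 0ℓ
≡-mod-setoid m = record
  { Carrier       = ℤ
  ; _≈_           = λ x y → x ≡ y mod m
  ; isEquivalence = record { refl = ≡-mod-refl ; sym = ≡-mod-sym ; trans = ≡-mod-trans }
  }

module ≡-mod-Reasoning (m : ℕ) = SetoidReasoning (≡-mod-setoid m)

≡-mod-∣ : m ∣ℕ n → x ≡ y mod n → x ≡ y mod m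
≡-mod-∣ m∣n (∣⇒≡-mod n∣x-y) = ∣⇒≡-mod (∣-trans (∣ᵤ⇒∣ m∣n) n∣x-y)

∣-lcm : + m ∣ x → + n ∣ x → + lcm m n ∣ x
∣-lcm m∣x n∣x = ∣ᵤ⇒∣ (lcm-least (∣⇒∣ᵤ m∣x) (∣⇒∣ᵤ n∣x))

≡-mod-lcm : x ≡ y mod m → x ≡ y mod n → x ≡ y mod lcm m n
≡-mod-lcm (∣⇒≡-mod m∣x-y) (∣⇒≡-mod n∣x-y) = ∣⇒≡-mod (∣-lcm m∣x-y n∣x-y)

-1^even : 2 ∣ℕ n → -1ℤ ^ n ≡ 1ℤ
-1^even (ℕ.divides q refl) = begin
  -1ℤ ^ (q ℕ.* 2)   ≡⟨ cong (-1ℤ ^_) (ℕ.*-comm q 2) ⟩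
  -1ℤ ^ (2 ℕ.* q)   ≡⟨ ℤ.^-*-assoc -1ℤ 2 q ⟨
  1ℤ ^ q            ≡⟨ ℤ.^-zeroˡ q ⟩
  1ℤ                ∎
  where open ≡-Reasoning

-1^odd : ¬ 2 ∣ℕ n → -1ℤ ^ n ≡ -1ℤ
-1^odd {n} 2∤n with n % 2 | m%n<n n 2 | m≡m%n+[m/n]*n n 2
... | 0           | _            | n≡q*2   = contradiction (ℕ.divides (n / 2) n≡q*2) 2∤n
... | 1           | _            | n≡1+q*2 =
  trans (cong (-1ℤ ^_) n≡1+q*2) (cong (-1ℤ *_) (-1^even (ℕ.n∣m*n (n / 2))))
... | suc (suc _) | s≤s (s≤s ()) | _

odd⇒≡1+q*2 : ¬ (+ 2 ∣ x) → ∃[ q ] x ≡ 1ℤ + q * + 2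
odd⇒≡1+q*2 {x} 2∤x with x %ℕ 2 | n%ℕd<d x 2 | a≡a%ℕn+[a/ℕn]*n x 2
... | 0           | _            | x≡0+q*2 =
  contradiction (divides (x /ℕ 2) (trans x≡0+q*2 (ℤ.+-identityˡ _))) 2∤x
... | 1           | _            | x≡1+q*2 = x /ℕ 2 , x≡1+q*2
... | suc (suc _) | s≤s (s≤s ()) | _

2∣4 : 2 ∣ℕ 4
2∣4 = ℕ.divides 2 refl

2∣b*n⇒2∣b : ∀ b → ¬ 2 ∣ℕ n → 2 ∣ℕ b ℕ.* n → 2 ∣ℕ b
2∣b*n⇒2∣b {n} b 2∤n 2∣b*n =
  [ id , (λ 2∣n → contradiction 2∣n 2∤n) ]′ (euclidsLemma b n prime[2] 2∣b*n)

4∣b*n⇒2∣b : ∀ b → ¬ 4 ∣ℕ n → 4 ∣ℕ b ℕ.* n → 2 ∣ℕ b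
4∣b*n⇒2∣b {n} b 4∤n 4∣b*n with euclidsLemma b n prime[2] (ℕ.∣-trans 2∣4 4∣b*n)
... | inj₁ 2∣b                 = 2∣b
... | inj₂ (ℕ.divides k refl) = 2∣b*n⇒2∣b b
  (λ 2∣k → 4∤n (ℕ.*-pres-∣ 2∣k (ℕ.∣-refl {2})))
  (ℕ.*-cancelʳ-∣ 2 (subst (4 ∣ℕ_) (sym (ℕ.*-assoc b k 2)) 4∣b*n))

∣[x+x]∧∣[K*x]⇒∣x : OddInt K ⊎ OddNat m → + m ∣ x + x → + m ∣ K * x → + m ∣ x
∣[x+x]∧∣[K*x]⇒∣x {x = x} (inj₁ K-odd) m∣2x m∣Kx with odd⇒≡1+q*2 K-odd
... | q , refl = subst (_ ∣_) (combination q x) (∣m∣n⇒∣m-n m∣Kx (∣n⇒∣m*n q m∣2x))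
  where
  combination : ∀ q x → (1ℤ + q * + 2) * x - q * (x + x) ≡ x
  combination = solve-∀
∣[x+x]∧∣[K*x]⇒∣x {m = m} {x = x} (inj₂ m-odd) m∣2x _ with odd⇒≡1+q*2 m-odd
... | q , m≡1+q*2 =
  subst (_ ∣_) (combination q x) (∣m∣n⇒∣m-n (∣n⇒∣m*n (1ℤ + q) m∣2x) m∣x*m)
  where
  combination : ∀ q x → (1ℤ + q) * (x + x) - x * (1ℤ + q * + 2) ≡ x
  combination = solve-∀
  m∣x*m : + m ∣ x * (1ℤ + q * + 2)
  m∣x*m = subst (λ t → + m ∣ x * t) m≡1+q*2 (∣n⇒∣m*n x ∣-refl)

-- Multiplicative orders

least-witness : {P : Pred ℕ 0ℓ} → Decidable P → P n → ∃[ j ] P j × (∀ {i} → P i → j ≤ i)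
least-witness {n = n} {P = P} P? = <-rec Goal search n
  where
  Goal : ℕ → Set
  Goal n = P n → ∃[ j ] P j × (∀ {i} → P i → j ≤ i)
  search : ∀ n → (∀ {i} → i < n → Goal i) → Goal n
  search n below Pn with ℕ.anyUpTo? P? n
  ... | yes (i , i<n , Pi) = below i<n Pi
  ... | no  ∄i<n           = n , Pn , λ {i} Pi → ℕ.≮⇒≥ (λ i<n → ∄i<n (i , i<n , Pi))

record IsMulOrder (m : ℕ) (x : ℤ) (e : ℕ) : Set where
  field
    0<e   : 0 < e
    x^e≡1 : x ^ e ≡ 1ℤ mod m
    least : ∀ {c} → 0 < c → x ^ c ≡ 1ℤ mod m → e ≤ c

module _ {m : ℕ} {x : ℤ} where
  open ≡-mod-Reasoning m

  x^[e*q]≡1 : ∀ e q → x ^ e ≡ 1ℤ mod m → x ^ (e ℕ.* q) ≡ 1ℤ mod m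
  x^[e*q]≡1 e q x^e≡1 = begin
    x ^ (e ℕ.* q)  ≡⟨ ℤ.^-*-assoc x e q ⟨
    (x ^ e) ^ q    ≈⟨ ^-cong-mod q x^e≡1 ⟩
    1ℤ ^ q         ≡⟨ ℤ.^-zeroˡ q ⟩
    1ℤ             ∎

  isMulOrder-∣ : ∀ {e c} → IsMulOrder m x e → x ^ c ≡ 1ℤ mod m → e ∣ℕ c
  isMulOrder-∣ {e} {c} o x^c≡1 = ℕ.m%n≡0⇒n∣m c e (r≡0 (m%n<n c e) x^r≡1)
    where
    open IsMulOrder o
    instance
      e-nonZero : NonZero e
      e-nonZero = >-nonZero 0<e
    x^r≡1 : x ^ (c % e) ≡ 1ℤ mod m
    x^r≡1 = begin
      x ^ (c % e)                        ≡⟨ ℤ.*-identityʳ _ ⟨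
      x ^ (c % e) * 1ℤ                   ≈⟨ *-congˡ-mod (x ^ (c % e)) (x^[e*q]≡1 e (c / e) x^e≡1) ⟨
      x ^ (c % e) * x ^ (e ℕ.* (c / e))  ≡⟨ ℤ.^-distribˡ-+-* x (c % e) _ ⟨
      x ^ (c % e ℕ.+ e ℕ.* (c / e))      ≡⟨ cong (λ t → x ^ (c % e ℕ.+ t)) (ℕ.*-comm e (c / e)) ⟩
      x ^ (c % e ℕ.+ c / e ℕ.* e)        ≡⟨ cong (x ^_) (m≡m%n+[m/n]*n c e) ⟨
      x ^ c                              ≈⟨ x^c≡1 ⟩
      1ℤ                                 ∎
    r≡0 : ∀ {r} → r < e → x ^ r ≡ 1ℤ mod m → r ≡ 0
    r≡0 {zero}  _   _       = refl
    r≡0 {suc r} r<e x^r≡1 = contradiction (least z<s x^r≡1) (ℕ.<⇒≱ r<e)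

  isMulOrder-exists : ∀ {c} → 0 < c → x ^ c ≡ 1ℤ mod m → ∃[ e ] IsMulOrder m x e
  isMulOrder-exists 0<c x^c≡1
    with e , (0<e , x^e≡1) , minimal
           ← least-witness (λ e → 0 <? e ×-dec x ^ e ≡? 1ℤ mod m) (0<c , x^c≡1)
    = e , record { 0<e = 0<e ; x^e≡1 = x^e≡1 ; least = λ 0<c x^c≡1 → minimal (0<c , x^c≡1) }

  x≡1⇒x¹≡1 : x ≡ 1ℤ mod m → x ^ 1 ≡ 1ℤ mod m
  x≡1⇒x¹≡1 = ≡-mod-trans (≡⇒≡-mod (ℤ.^-identityʳ x))

  x¹≡1⇒x≡1 : x ^ 1 ≡ 1ℤ mod m → x ≡ 1ℤ mod m
  x¹≡1⇒x≡1 = ≡-mod-trans (≡⇒≡-mod (sym (ℤ.^-identityʳ x)))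

  isMulOrder-1 : x ≡ 1ℤ mod m → IsMulOrder m x 1
  isMulOrder-1 x≡1 = record { 0<e = z<s ; x^e≡1 = x≡1⇒x¹≡1 x≡1 ; least = λ 0<c _ → 0<c }

  isMulOrder-≢1 : ∀ {e} → IsMulOrder m x e → 1 < e → ¬ x ≡ 1ℤ mod m
  isMulOrder-≢1 o 1<e x≡1 = ℕ.<⇒≱ 1<e (IsMulOrder.least o z<s (x≡1⇒x¹≡1 x≡1))

  isMulOrder[1]⇒≡1 : IsMulOrder m x 1 → x ≡ 1ℤ mod m
  isMulOrder[1]⇒≡1 o = x¹≡1⇒x≡1 (IsMulOrder.x^e≡1 o)

  isMulOrder-2 : ¬ x ≡ 1ℤ mod m → x ^ 2 ≡ 1ℤ mod m → IsMulOrder m x 2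
  isMulOrder-2 x≢1 x²≡1 = record { 0<e = z<s ; x^e≡1 = x²≡1 ; least = least }
    where
    least : ∀ {c} → 0 < c → x ^ c ≡ 1ℤ mod m → 2 ≤ c
    least {1}           _ x¹≡1 = contradiction (x¹≡1⇒x≡1 x¹≡1) x≢1
    least {suc (suc c)} _ _    = s≤s (s≤s z≤n)

  isMulOrder-4 : ¬ x ^ 2 ≡ 1ℤ mod m → x ^ 4 ≡ 1ℤ mod m → IsMulOrder m x 4
  isMulOrder-4 x²≢1 x⁴≡1 = record { 0<e = z<s ; x^e≡1 = x⁴≡1 ; least = least }
    where
    x≢1 : ¬ x ≡ 1ℤ mod m
    x≢1 x≡1 = x²≢1 (^-cong-mod 2 x≡1)
    least : ∀ {c} → 0 < c → x ^ c ≡ 1ℤ mod m → 4 ≤ c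
    least {1} _ x¹≡1 = contradiction (x¹≡1⇒x≡1 x¹≡1) x≢1
    least {2} _ x²≡1 = contradiction x²≡1 x²≢1
    least {3} _ x³≡1 = contradiction x≡1 x≢1
      where
      x≡1 : x ≡ 1ℤ mod m
      x≡1 = begin
        x          ≡⟨ ℤ.*-identityʳ x ⟨
        x * 1ℤ     ≈⟨ *-congˡ-mod x x³≡1 ⟨
        x * x ^ 3  ≈⟨ x⁴≡1 ⟩
        1ℤ         ∎
    least {suc (suc (suc (suc c)))} _ _ = s≤s (s≤s (s≤s (s≤s z≤n)))

  x^c≡1⇒2∣c : ∀ {c} → x ^ 4 ≡ 1ℤ mod m → ¬ x ≡ 1ℤ mod m → x ^ c ≡ 1ℤ mod m → 2 ∣ℕ c
  x^c≡1⇒2∣c x⁴≡1 x≢1 x^c≡1 with x ^ 2 ≡? 1ℤ mod m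
  ... | yes x²≡1 = isMulOrder-∣ (isMulOrder-2 x≢1 x²≡1) x^c≡1
  ... | no  x²≢1 = ℕ.∣-trans 2∣4 (isMulOrder-∣ (isMulOrder-4 x²≢1 x⁴≡1) x^c≡1)

-- Identities for the K-Fibonacci sequence

F-+ : ∀ K a b → F K (suc (a ℕ.+ b)) ≡ F K (suc a) * F K (suc b) + F K a * F K b
F-+ K zero          b = initial (F K (suc b)) (F K b)
  where
  initial : ∀ y x → y ≡ 1ℤ * y + 0ℤ * x
  initial = solve-∀
F-+ K (suc zero)    b = initial K (F K (suc b)) (F K b)
  where
  initial : ∀ K y x → K * y + x ≡ (K * 1ℤ + 0ℤ) * y + 1ℤ * x
  initial = solve-∀
F-+ K (suc (suc a)) b =
  trans (cong₂ (λ u v → K * u + v) (F-+ K (suc a) b) (F-+ K a b)) (regroup K _ _ _ _ _)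
  where
  regroup : ∀ K x₂ x₁ x₀ y₁ y₀ → K * (x₂ * y₁ + x₁ * y₀) + (x₁ * y₁ + x₀ * y₀)
                                ≡ (K * x₂ + x₁) * y₁ + (K * x₁ + x₀) * y₀
  regroup = solve-∀

F-cassini : ∀ K n → F K (suc n) * F K (suc n) - F K (suc (suc n)) * F K n ≡ -1ℤ ^ n
F-cassini K zero    = initial K
  where
  initial : ∀ K → 1ℤ * 1ℤ - (K * 1ℤ + 0ℤ) * 0ℤ ≡ 1ℤ
  initial = solve-∀
F-cassini K (suc n) = trans (step K (F K (suc n)) (F K n)) (cong (-1ℤ *_) (F-cassini K n))
  where
  step : ∀ K y x → (K * y + x) * (K * y + x) - (K * (K * y + x) + y) * y
                  ≡ -1ℤ * (y * y - (K * y + x) * x)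
  step = solve-∀

-- With f₀, f₁, f₂ = F_{k−1}, F_k, F_{k+1}: F_{2k} = f₁f₂ + f₀f₁, F_{2k+1} = f₂² + f₁², and the
-- Cassini identity at the odd index k − 1 gives f₂f₀ − f₁² = 1. Combining these three yields
-- m ∣ 2f₁ and m ∣ K f₁, and K or m odd then gives m ∣ f₁.
F-half-zero : OddInt K ⊎ OddNat m → 2 ∣ℕ k →
              + m ∣ F K (k ℕ.+ k) → F K (suc (k ℕ.+ k)) ≡ 1ℤ mod m → + m ∣ F K k
F-half-zero {k = zero} _ _ _ _ = divides 0ℤ refl
F-half-zero {K} {m} {suc k′} parity 2∣k m∣F[2k] F[2k+1]≡1 =
  ∣[x+x]∧∣[K*x]⇒∣x parity m∣2f₁ m∣Kf₁
  where
  f₀ f₁ f₂ : ℤ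
  f₀ = F K k′
  f₁ = F K (suc k′)
  f₂ = F K (suc (suc k′))
  m∣F[2k]′ : + m ∣ f₁ * f₂ + f₀ * f₁
  m∣F[2k]′ = subst (+ m ∣_) (F-+ K k′ (suc k′)) m∣F[2k]
  m∣F[2k+1]-1 : + m ∣ f₂ * f₂ + f₁ * f₁ - 1ℤ
  m∣F[2k+1]-1 = ≡-mod⇒∣ (subst (λ t → t ≡ 1ℤ mod m) (F-+ K (suc k′) (suc k′)) F[2k+1]≡1)
  cassini≡0 : f₂ * f₀ - f₁ * f₁ - 1ℤ ≡ 0ℤ
  cassini≡0 = begin
    f₂ * f₀ - f₁ * f₁ - 1ℤ          ≡⟨ negate f₁ f₂ f₀ ⟩
    -1ℤ * (f₁ * f₁ - f₂ * f₀) - 1ℤ  ≡⟨ cong (λ t → -1ℤ * t - 1ℤ) (F-cassini K k′) ⟩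
    -1ℤ ^ suc k′ - 1ℤ               ≡⟨ cong (_- 1ℤ) (-1^even 2∣k) ⟩
    0ℤ                              ∎
    where
    open ≡-Reasoning
    negate : ∀ y z x → z * x - y * y - 1ℤ ≡ -1ℤ * (y * y - z * x) - 1ℤ
    negate = solve-∀
  m∣cassini : + m ∣ f₂ * f₀ - f₁ * f₁ - 1ℤ
  m∣cassini = subst (+ m ∣_) (sym cassini≡0) (divides 0ℤ refl)
  m∣2f₁ : + m ∣ f₁ + f₁
  m∣2f₁ = subst (+ m ∣_) (combination f₀ f₁ f₂)
    (∣m∣n⇒∣m-n (∣m∣n⇒∣m-n (∣n⇒∣m*n f₂ m∣F[2k]′) (∣n⇒∣m*n f₁ m∣F[2k+1]-1))
                (∣n⇒∣m*n f₁ m∣cassini))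
    where
    combination : ∀ x y z →
      z * (y * z + x * y) - y * (z * z + y * y - 1ℤ) - y * (z * x - y * y - 1ℤ) ≡ y + y
    combination = solve-∀
  m∣Kf₁ : + m ∣ K * f₁
  m∣Kf₁ = subst (+ m ∣_) (combination K f₀ f₁)
    (∣m∣n⇒∣m-n (∣m∣n⇒∣m-n (∣n⇒∣m*n f₀ m∣F[2k+1]-1) (∣n⇒∣m*n f₁ m∣F[2k]′))
                (∣n⇒∣m*n f₂ m∣cassini))
    where
    combination : ∀ K x y → let z = K * y + x in
      x * (z * z + y * y - 1ℤ) - y * (y * z + x * y) - z * (z * x - y * y - 1ℤ) ≡ K * y
    combination = solve-∀

residue : ∀ m .{{_ : NonZero m}} → ℤ → Fin m
residue m x = fromℕ< (n%ℕd<d x m)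

≡-mod-%ℕ : .{{_ : NonZero m}} → x ≡ + (x %ℕ m) mod m
≡-mod-%ℕ {m} {x} = ∣⇒≡-mod (divides (x /ℕ m) (begin
  x - + (x %ℕ m)                              ≡⟨ cong (_- + (x %ℕ m)) (a≡a%ℕn+[a/ℕn]*n x m) ⟩
  (+ (x %ℕ m) + x /ℕ m * + m) - + (x %ℕ m)    ≡⟨ cancel (+ (x %ℕ m)) (x /ℕ m * + m) ⟩
  x /ℕ m * + m                                ∎))
  where
  open ≡-Reasoning
  cancel : ∀ r t → (r + t) - r ≡ t
  cancel = solve-∀

residue-≡⇒≡-mod : .{{_ : NonZero m}} → residue m x ≡ residue m y → x ≡ y mod m
residue-≡⇒≡-mod {m} {x} {y} same = begin
  x             ≈⟨ ≡-mod-%ℕ ⟩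
  + (x %ℕ m)    ≡⟨ cong +_ x%m≡y%m ⟩
  + (y %ℕ m)    ≈⟨ ≡-mod-%ℕ ⟨
  y             ∎
  where
  open ≡-mod-Reasoning m
  x%m≡y%m : x %ℕ m ≡ y %ℕ m
  x%m≡y%m = trans (sym (Fin.toℕ-fromℕ< _)) (trans (cong toℕ same) (Fin.toℕ-fromℕ< _))

F-≡-shift⇒zero : ∀ {d} i → F K i ≡ F K (i ℕ.+ d) mod m →
                 F K (suc i) ≡ F K (suc i ℕ.+ d) mod m → + m ∣ F K d
F-≡-shift⇒zero zero    F₀≡F_d _ = ≡0-mod⇒∣ (≡-mod-sym F₀≡F_d)
F-≡-shift⇒zero {K} {m} {d} (suc i) F₁≡ F₂≡ = F-≡-shift⇒zero i F₀≡ F₁≡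
  where
  open ≡-mod-Reasoning m
  recurrence : ∀ K y x → (K * y + x) - K * y ≡ x
  recurrence = solve-∀
  F₀≡ : F K i ≡ F K (i ℕ.+ d) mod m
  F₀≡ = begin
    F K i
      ≡⟨ recurrence K (F K (suc i)) (F K i) ⟨
    F K (suc (suc i)) - K * F K (suc i)
      ≈⟨ +-cong-mod F₂≡ (-‿cong-mod (*-congˡ-mod K F₁≡)) ⟩
    F K (suc (suc i) ℕ.+ d) - K * F K (suc i ℕ.+ d)
      ≡⟨ recurrence K (F K (suc (i ℕ.+ d))) (F K (i ℕ.+ d)) ⟩
    F K (i ℕ.+ d)
      ∎

collision⇒zero : ∀ {i j} → i < j →
                 F K i ≡ F K j mod m → F K (suc i) ≡ F K (suc j) mod m → + m ∣ F K (j ℕ.∸ i)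
collision⇒zero {K} {m} {i} {j} i<j Fᵢ≡Fⱼ Fᵢ₊₁≡Fⱼ₊₁ = F-≡-shift⇒zero i
  (subst (λ t → F K i ≡ F K t mod m) j≡i+d Fᵢ≡Fⱼ)
  (subst (λ t → F K (suc i) ≡ F K (suc t) mod m) j≡i+d Fᵢ₊₁≡Fⱼ₊₁)
  where
  j≡i+d : j ≡ i ℕ.+ (j ℕ.∸ i)
  j≡i+d = sym (ℕ.m+[n∸m]≡n (ℕ.<⇒≤ i<j))

F-state : ∀ K m .{{_ : NonZero m}} → ℕ → Fin (m ℕ.* m)
F-state K m i = combine (residue m (F K i)) (residue m (F K (suc i)))

-- Pigeonhole on pairs of consecutive residues: since the recurrence runs backwards, a repeated
-- pair at i < j gives F_{j−i} ≡ F_0 = 0.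
F-has-positive-zero : ∀ K m .{{_ : NonZero m}} → ∃[ d ] 0 < d × + m ∣ F K d
F-has-positive-zero K m
  with i , j , i<j , same ← Fin.pigeonhole (ℕ.n<1+n (m ℕ.* m)) (F-state K m ∘ toℕ)
  with sameᵢ , sameᵢ₊₁ ← Fin.combine-injective _ _ _ _ same
  = toℕ j ℕ.∸ toℕ i
  , ℕ.m<n⇒0<n∸m i<j
  , collision⇒zero i<j (residue-≡⇒≡-mod sameᵢ) (residue-≡⇒≡-mod sameᵢ₊₁)

-- The rank of apparition

module _ {P : Pred ℕ 0ℓ} (P? : Decidable P) where
  private
    count : ℕ → ℕ
    count n = length (filter P? (upTo n))

    count-suc : ∀ n → count (suc n) ≡ count n ℕ.+ length (filter P? [ n ])
    count-suc n = begin
      count (suc n)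
        ≡⟨ cong (length ∘ filter P?) (List.upTo-∷ʳ n) ⟨
      length (filter P? (upTo n ++ [ n ]))
        ≡⟨ cong length (List.filter-++ P? (upTo n) [ n ]) ⟩
      length (filter P? (upTo n) ++ filter P? [ n ])
        ≡⟨ List.length-++ (filter P? (upTo n)) ⟩
      count n ℕ.+ length (filter P? [ n ])
        ∎
      where open ≡-Reasoning

    count-accept : P n → count (suc n) ≡ suc (count n)
    count-accept {n} Pn = trans (count-suc n) (trans
      (cong (λ l → count n ℕ.+ length l) (List.filter-accept P? Pn)) (ℕ.+-comm (count n) 1))

    count-reject : ¬ P n → count (suc n) ≡ count n
    count-reject {n} ¬Pn = trans (count-suc n) (trans
      (cong (λ l → count n ℕ.+ length l) (List.filter-reject P? ¬Pn)) (ℕ.+-identityʳ (count n)))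

  count-multiples : ∀ {α} → 0 < α → (∀ {j} → P j → α ∣ℕ j) → (∀ {j} → α ∣ℕ j → P j) →
                    ∀ t → length (filter P? (upTo (t ℕ.* α))) ≡ t
  count-multiples {suc a} _ P⇒α∣ α∣⇒P = multiples
    where
    α : ℕ
    α = suc a
    block : ∀ t → count (t ℕ.* α) ≡ t → ∀ r → r < α → count (t ℕ.* α ℕ.+ suc r) ≡ suc t
    block t ct zero    _   = trans (cong count (ℕ.+-comm (t ℕ.* α) 1))
      (trans (count-accept (α∣⇒P (ℕ.n∣m*n t))) (cong suc ct))
    block t ct (suc r) r<α = trans (cong count (ℕ.+-suc (t ℕ.* α) (suc r)))
      (trans (count-reject ¬P) (block t ct r (ℕ.<⇒≤ r<α)))
      where
      ¬P : ¬ P (t ℕ.* α ℕ.+ suc r)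
      ¬P P[tα+1+r] = ℕ.<⇒≱ r<α (ℕ.∣⇒≤ (ℕ.∣m+n∣m⇒∣n (P⇒α∣ P[tα+1+r]) (ℕ.n∣m*n t)))
    multiples : ∀ t → count (t ℕ.* α) ≡ t
    multiples zero    = refl
    multiples (suc t) =
      trans (cong count (ℕ.+-comm α (t ℕ.* α))) (block t (multiples t) a ℕ.≤-refl)

record Rank (K : ℤ) (m : ℕ) : Set where
  field
    α       : ℕ
    0<α     : 0 < α
    m∣F[α]  : + m ∣ F K α
    α-least : ∀ {j} → 0 < j → + m ∣ F K j → α ≤ j

  s : ℤ
  s = F K (suc α)

-- Opaque, so that comparing ranks never unfolds the search for the least zero.
opaque
  rank-from-zero : ∀ {j} → 0 < j → + m ∣ F K j → Rank K m
  rank-from-zero {m = m} {K = K} 0<j m∣Fⱼ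
    with α , (0<α , m∣F[α]) , minimal
           ← least-witness (λ i → 0 <? i ×-dec + m ∣? F K i) (0<j , m∣Fⱼ)
    = record { α = α ; 0<α = 0<α ; m∣F[α] = m∣F[α]
             ; α-least = λ 0<i m∣Fᵢ → minimal (0<i , m∣Fᵢ) }

rank : ∀ K m .{{_ : NonZero m}} → Rank K m
rank K m with _ , 0<d , m∣F[d] ← F-has-positive-zero K m = rank-from-zero 0<d m∣F[d]

2∤1 : ¬ + 2 ∣ 1ℤ
2∤1 2∣1 with () ← ℕ.∣1⇒≡1 (∣⇒∣ᵤ 2∣1)

2∤F[2] : OddInt K → ¬ + 2 ∣ F K 2
2∤F[2] {K} K-odd 2∣F₂ = K-odd (subst (+ 2 ∣_) (F₂≡K K) 2∣F₂)
  where
  F₂≡K : ∀ K → K * 1ℤ + 0ℤ ≡ K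
  F₂≡K = solve-∀

2∣F[3] : OddInt K → + 2 ∣ F K 3
2∣F[3] K-odd with q , refl ← odd⇒≡1+q*2 K-odd = divides (q * q * + 2 + q * + 2 + 1ℤ) (expand q)
  where
  expand : ∀ q → let K = 1ℤ + q * + 2 in
    K * (K * 1ℤ + 0ℤ) + 1ℤ ≡ (q * q * + 2 + q * + 2 + 1ℤ) * + 2
  expand = solve-∀

F[4]≡1-mod-2 : OddInt K → F K 4 ≡ 1ℤ mod 2
F[4]≡1-mod-2 K-odd with q , refl ← odd⇒≡1+q*2 K-odd =
  ∣⇒≡-mod (divides (q * q * q * + 4 + q * q * + 6 + q * + 5 + 1ℤ) (expand q))
  where
  expand : ∀ q → let K = 1ℤ + q * + 2 in
    K * (K * (K * 1ℤ + 0ℤ) + 1ℤ) + (K * 1ℤ + 0ℤ) - 1ℤ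
      ≡ (q * q * q * + 4 + q * q * + 6 + q * + 5 + 1ℤ) * + 2
  expand = solve-∀

rank-of-2 : OddInt K → m ≡ 2 → (r : Rank K m) → Rank.α r ≡ 3
rank-of-2 K-odd refl r
  with Rank.α r | Rank.0<α r | Rank.m∣F[α] r | Rank.α-least r {3} z<s (2∣F[3] K-odd)
... | 1                       | _ | 2∣F₁ | _                  = contradiction 2∣F₁ 2∤1
... | 2                       | _ | 2∣F₂ | _                  = contradiction 2∣F₂ (2∤F[2] K-odd)
... | 3                       | _ | _    | _                  = refl
... | suc (suc (suc (suc _))) | _ | _    | s≤s (s≤s (s≤s ()))

s≡1-mod-2 : OddInt K → m ≡ 2 → (r : Rank K m) → Rank.s r ≡ 1ℤ mod m
s≡1-mod-2 {K} K-odd refl r =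
  subst (λ α → F K (suc α) ≡ 1ℤ mod 2) (sym (rank-of-2 K-odd refl r)) (F[4]≡1-mod-2 K-odd)

m≡2⇒K-odd : OddInt K ⊎ OddNat m → m ≡ 2 → OddInt K
m≡2⇒K-odd (inj₁ K-odd) _    = K-odd
m≡2⇒K-odd (inj₂ m-odd) refl = contradiction ∣-refl m-odd

hasOrder-unique : ∀ {e e′} → HasOrder K m e → HasOrder K m e′ → e ≡ e′
hasOrder-unique (p , (p-period , p-least) , p-count) (p′ , (p′-period , p′-least) , p′-count) =
  trans (sym p-count) (trans (cong (zeroCount _ _) p≡p′) p′-count)
  where
  p≡p′ : p ≡ p′
  p≡p′ = ℕ.≤-antisym (p-least p′ p′-period) (p′-least p p-period)

module RankProperties {K : ℤ} {m : ℕ} (r : Rank K m) where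
  open Rank r public
  open ≡-mod-Reasoning m

  instance
    α-nonZero : NonZero α
    α-nonZero = >-nonZero 0<α

  F[α]≡0 : F K α ≡ 0ℤ mod m
  F[α]≡0 = ∣⇒≡0-mod m∣F[α]

  F[n+α]≡s*F[n] : ∀ n → F K (n ℕ.+ α) ≡ s * F K n mod m
  F[n+α]≡s*F[n] zero    = ≡-mod-trans F[α]≡0 (≡⇒≡-mod (sym (ℤ.*-zeroʳ s)))
  F[n+α]≡s*F[n] (suc n) = begin
    F K (suc (n ℕ.+ α))              ≡⟨ F-+ K n α ⟩
    F K (suc n) * s + F K n * F K α  ≈⟨ +-congˡ-mod (F K (suc n) * s) (*-congˡ-mod (F K n) F[α]≡0) ⟩
    F K (suc n) * s + F K n * 0ℤ     ≡⟨ drop (F K (suc n)) s (F K n) ⟩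
    s * F K (suc n)                  ∎
    where
    drop : ∀ y s x → y * s + x * 0ℤ ≡ s * y
    drop = solve-∀

  F[n+k*α]≡s^k*F[n] : ∀ k n → F K (n ℕ.+ k ℕ.* α) ≡ s ^ k * F K n mod m
  F[n+k*α]≡s^k*F[n] zero    n =
    ≡⇒≡-mod (trans (cong (F K) (ℕ.+-identityʳ n)) (sym (ℤ.*-identityˡ (F K n))))
  F[n+k*α]≡s^k*F[n] (suc k) n = begin
    F K (n ℕ.+ (α ℕ.+ k ℕ.* α))  ≡⟨ cong (F K) (n+[α+kα]≡[n+kα]+α) ⟩
    F K (n ℕ.+ k ℕ.* α ℕ.+ α)    ≈⟨ F[n+α]≡s*F[n] (n ℕ.+ k ℕ.* α) ⟩
    s * F K (n ℕ.+ k ℕ.* α)      ≈⟨ *-congˡ-mod s (F[n+k*α]≡s^k*F[n] k n) ⟩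
    s * (s ^ k * F K n)          ≡⟨ ℤ.*-assoc s (s ^ k) (F K n) ⟨
    s ^ suc k * F K n            ∎
    where
    n+[α+kα]≡[n+kα]+α : n ℕ.+ (α ℕ.+ k ℕ.* α) ≡ n ℕ.+ k ℕ.* α ℕ.+ α
    n+[α+kα]≡[n+kα]+α =
      trans (cong (n ℕ.+_) (ℕ.+-comm α (k ℕ.* α))) (sym (ℕ.+-assoc n (k ℕ.* α) α))

  F[1+k*α]≡s^k : ∀ k → F K (suc (k ℕ.* α)) ≡ s ^ k mod m
  F[1+k*α]≡s^k k = ≡-mod-trans (F[n+k*α]≡s^k*F[n] k 1) (≡⇒≡-mod (ℤ.*-identityʳ (s ^ k)))

  m∣F[k*α] : ∀ k → + m ∣ F K (k ℕ.* α)
  m∣F[k*α] k =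
    ≡0-mod⇒∣ (≡-mod-trans (F[n+k*α]≡s^k*F[n] k 0) (≡⇒≡-mod (ℤ.*-zeroʳ (s ^ k))))

  s²≡-1^α : s ^ 2 ≡ -1ℤ ^ α mod m
  s²≡-1^α = begin
    s ^ 2                                 ≡⟨ cong (s *_) (ℤ.*-identityʳ s) ⟩
    s * s                                 ≡⟨ split s t (F K α) ⟩
    (s * s - t * F K α) + t * F K α       ≈⟨ +-congˡ-mod (s * s - t * F K α) (*-congˡ-mod t F[α]≡0) ⟩
    (s * s - t * F K α) + t * 0ℤ          ≡⟨ drop (s * s - t * F K α) t ⟩
    s * s - t * F K α                     ≡⟨ F-cassini K α ⟩
    -1ℤ ^ α                               ∎
    where
    t : ℤ
    t = F K (suc (suc α))
    split : ∀ s t f → s * s ≡ (s * s - t * f) + t * f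
    split = solve-∀
    drop : ∀ c t → c + t * 0ℤ ≡ c
    drop = solve-∀

  s^4≡1 : s ^ 4 ≡ 1ℤ mod m
  s^4≡1 = begin
    s ^ 4            ≡⟨ ℤ.^-*-assoc s 2 2 ⟨
    (s ^ 2) ^ 2      ≈⟨ ^-cong-mod 2 s²≡-1^α ⟩
    (-1ℤ ^ α) ^ 2    ≡⟨ ℤ.^-*-assoc -1ℤ α 2 ⟩
    -1ℤ ^ (α ℕ.* 2)  ≡⟨ -1^even (ℕ.n∣m*n α) ⟩
    1ℤ               ∎

  2∣α⇒s²≡1 : 2 ∣ℕ α → s ^ 2 ≡ 1ℤ mod m
  2∣α⇒s²≡1 2∣α = ≡-mod-trans s²≡-1^α (≡⇒≡-mod (-1^even 2∣α))

  s*y≡0⇒y≡0 : s * y ≡ 0ℤ mod m → y ≡ 0ℤ mod m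
  s*y≡0⇒y≡0 {y} s*y≡0 = begin
    y                ≡⟨ ℤ.*-identityˡ y ⟨
    1ℤ * y           ≈⟨ *-congʳ-mod y s^4≡1 ⟨
    s ^ 4 * y        ≡⟨ cong (_* y) (ℤ.*-comm s (s ^ 3)) ⟩
    s ^ 3 * s * y    ≡⟨ ℤ.*-assoc (s ^ 3) s y ⟩
    s ^ 3 * (s * y)  ≈⟨ *-congˡ-mod (s ^ 3) s*y≡0 ⟩
    s ^ 3 * 0ℤ       ≡⟨ ℤ.*-zeroʳ (s ^ 3) ⟩
    0ℤ               ∎

  s^k*y≡0⇒y≡0 : ∀ k → s ^ k * y ≡ 0ℤ mod m → y ≡ 0ℤ mod m
  s^k*y≡0⇒y≡0 {y} zero    s^k*y≡0 = ≡-mod-trans (≡⇒≡-mod (sym (ℤ.*-identityˡ y))) s^k*y≡0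
  s^k*y≡0⇒y≡0 {y} (suc k) s^k*y≡0 =
    s^k*y≡0⇒y≡0 k (s*y≡0⇒y≡0 (≡-mod-trans (≡⇒≡-mod (sym (ℤ.*-assoc s (s ^ k) y))) s^k*y≡0))

  zero-below-α : ∀ {j} → j < α → + m ∣ F K j → j ≡ 0
  zero-below-α {zero}  _   _      = refl
  zero-below-α {suc j} j<α m∣Fⱼ = contradiction (α-least z<s m∣Fⱼ) (ℕ.<⇒≱ j<α)

  m∣F⇒α∣ : ∀ {j} → + m ∣ F K j → α ∣ℕ j
  m∣F⇒α∣ {j} m∣Fⱼ = ℕ.m%n≡0⇒n∣m j α (zero-below-α (m%n<n j α) (≡0-mod⇒∣ F[j%α]≡0))
    where
    F[j%α]≡0 : F K (j % α) ≡ 0ℤ mod m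
    F[j%α]≡0 = s^k*y≡0⇒y≡0 (j / α) (begin
      s ^ (j / α) * F K (j % α)    ≈⟨ F[n+k*α]≡s^k*F[n] (j / α) (j % α) ⟨
      F K (j % α ℕ.+ j / α ℕ.* α)  ≡⟨ cong (F K) (m≡m%n+[m/n]*n j α) ⟨
      F K j                        ≈⟨ ∣⇒≡0-mod m∣Fⱼ ⟩
      0ℤ                           ∎)

  α∣⇒m∣F : ∀ {j} → α ∣ℕ j → + m ∣ F K j
  α∣⇒m∣F (ℕ.divides k refl) = m∣F[k*α] k

  odd-α⇒m≡2 : 1 < m → s ^ 2 ≡ 1ℤ mod m → ¬ 2 ∣ℕ α → m ≡ 2
  odd-α⇒m≡2 1<m s²≡1 2∤α = ℕ.≤-antisym (ℕ.∣⇒≤ (∣⇒∣ᵤ (≡-mod⇒∣ 1≡-1))) 1<m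
    where
    1≡-1 : 1ℤ ≡ -1ℤ mod m
    1≡-1 = begin
      1ℤ       ≈⟨ s²≡1 ⟨
      s ^ 2    ≈⟨ s²≡-1^α ⟩
      -1ℤ ^ α  ≡⟨ -1^odd 2∤α ⟩
      -1ℤ      ∎

  s≡1⇒2∣α : 1 < m → m ≢ 2 → s ≡ 1ℤ mod m → 2 ∣ℕ α
  s≡1⇒2∣α 1<m m≢2 s≡1 =
    decidable-stable (2 ℕ.∣? α) (m≢2 ∘ odd-α⇒m≡2 1<m (^-cong-mod 2 s≡1))

  order-2⇒2∣α : OddInt K ⊎ OddNat m → 1 < m → IsMulOrder m s 2 → 2 ∣ℕ α
  order-2⇒2∣α parity 1<m o = decidable-stable (2 ℕ.∣? α) λ 2∤α →
    let m≡2 = odd-α⇒m≡2 1<m (IsMulOrder.x^e≡1 o) 2∤α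
    in  isMulOrder-≢1 o (s≤s (s≤s z≤n)) (s≡1-mod-2 (m≡2⇒K-odd parity m≡2) m≡2 r)

  s≡1⇒4∤α : OddInt K ⊎ OddNat m → s ≡ 1ℤ mod m → ¬ 4 ∣ℕ α
  s≡1⇒4∤α _      _   (ℕ.divides zero    α≡0)   = ℕ.<-irrefl (sym α≡0) 0<α
  s≡1⇒4∤α parity s≡1 (ℕ.divides (suc q) α≡q*4) = ℕ.<⇒≱ h<α (α-least z<s m∣F[h])
    where
    h : ℕ
    h = suc q ℕ.* 2
    α≡h+h : α ≡ h ℕ.+ h
    α≡h+h = trans α≡q*4 (ℕ.*-distribˡ-+ (suc q) 2 2)
    h<α : h < α
    h<α = subst (h <_) (sym α≡h+h) (ℕ.m<m+n h z<s)
    m∣F[h] : + m ∣ F K h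
    m∣F[h] = F-half-zero parity (ℕ.n∣m*n (suc q))
      (subst (λ j → + m ∣ F K j) α≡h+h m∣F[α])
      (subst (λ j → F K (suc j) ≡ 1ℤ mod m) α≡h+h s≡1)

  s^b≡1⇒2∣b : OddInt K ⊎ OddNat m → ∀ b → 4 ∣ℕ b ℕ.* α → s ^ b ≡ 1ℤ mod m → 2 ∣ℕ b
  s^b≡1⇒2∣b parity b 4∣bα s^b≡1 with s ≡? 1ℤ mod m
  ... | yes s≡1 = 4∣b*n⇒2∣b b (s≡1⇒4∤α parity s≡1) 4∣bα
  ... | no  s≢1 = x^c≡1⇒2∣c s^4≡1 s≢1 s^b≡1

  -- The period is e·α, and its zeros are the e multiples of α below it.
  isMulOrder⇒hasOrder : ∀ {e} → IsMulOrder m s e → HasOrder K m e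
  isMulOrder⇒hasOrder {e} o = e ℕ.* α , (period , minimal) , zeroCount≡e
    where
    open IsMulOrder o
    period : IsPeriod K m (e ℕ.* α)
    period = ℕ.*-mono-< 0<e 0<α , λ n → ≡-mod⇒∣ (begin
      F K (n ℕ.+ e ℕ.* α)  ≈⟨ F[n+k*α]≡s^k*F[n] e n ⟩
      s ^ e * F K n        ≈⟨ *-congʳ-mod (F K n) x^e≡1 ⟩
      1ℤ * F K n           ≡⟨ ℤ.*-identityˡ (F K n) ⟩
      F K n                ∎)
    minimal : ∀ q → IsPeriod K m q → e ℕ.* α ≤ q
    minimal q (0<q , q-period) with m∣F⇒α∣ {q} (≡0-mod⇒∣ (∣⇒≡-mod (q-period 0)))
    ... | ℕ.divides zero    refl = contradiction 0<q (λ ())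
    ... | ℕ.divides (suc c) refl = ℕ.*-monoˡ-≤ α (least {suc c} z<s s^c≡1)
      where
      s^c≡1 : s ^ suc c ≡ 1ℤ mod m
      s^c≡1 = begin
        s ^ suc c                   ≈⟨ F[1+k*α]≡s^k (suc c) ⟨
        F K (suc (suc c ℕ.* α))     ≈⟨ ∣⇒≡-mod (q-period 1) ⟩
        1ℤ                          ∎
    zeroCount≡e : zeroCount K m (e ℕ.* α) ≡ e
    zeroCount≡e = count-multiples (λ j → + m ∣? F K j) 0<α m∣F⇒α∣ α∣⇒m∣F e

  hasOrder⇒isMulOrder : ∀ {e} → HasOrder K m e → IsMulOrder m s e
  hasOrder⇒isMulOrder ω≡e with e′ , o ← isMulOrder-exists {c = 4} z<s s^4≡1 =
    subst (IsMulOrder m s) (hasOrder-unique (isMulOrder⇒hasOrder o) ω≡e) o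

-- The rank of an lcm

module RankOfMultiple {K : ℤ} {d L : ℕ} (rd : Rank K d) (rL : Rank K L) (d∣L : d ∣ℕ L) where
  private
    module Rd = RankProperties rd
    module RL = RankProperties rL
  open ≡-mod-Reasoning d

  αd∣αL : Rd.α ∣ℕ RL.α
  αd∣αL = Rd.m∣F⇒α∣ (∣-trans (∣ᵤ⇒∣ d∣L) RL.m∣F[α])

  q : ℕ
  q = ℕ._∣_.quotient αd∣αL

  αL≡q*αd : RL.α ≡ q ℕ.* Rd.α
  αL≡q*αd = ℕ._∣_.equality αd∣αL

  2∣αd⇒2∣αL : 2 ∣ℕ Rd.α → 2 ∣ℕ RL.α
  2∣αd⇒2∣αL 2∣αd = subst (2 ∣ℕ_) (sym αL≡q*αd) (ℕ.∣n⇒∣m*n q 2∣αd)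

  sL≡sd^q : RL.s ≡ Rd.s ^ q mod d
  sL≡sd^q = subst (λ j → F K (suc j) ≡ Rd.s ^ q mod d) (sym αL≡q*αd) (Rd.F[1+k*α]≡s^k q)

  sd≡1⇒sL≡1 : Rd.s ≡ 1ℤ mod d → RL.s ≡ 1ℤ mod d
  sd≡1⇒sL≡1 sd≡1 = begin
    RL.s      ≈⟨ sL≡sd^q ⟩
    Rd.s ^ q  ≈⟨ ^-cong-mod q sd≡1 ⟩
    1ℤ ^ q    ≡⟨ ℤ.^-zeroˡ q ⟩
    1ℤ        ∎

  sL≡1⇒sd^q≡1 : RL.s ≡ 1ℤ mod L → Rd.s ^ q ≡ 1ℤ mod d
  sL≡1⇒sd^q≡1 sL≡1 = ≡-mod-trans (≡-mod-sym sL≡sd^q) (≡-mod-∣ d∣L sL≡1)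

  sL^c≡1⇒sd^[q*c]≡1 : ∀ c → RL.s ^ c ≡ 1ℤ mod L → Rd.s ^ (q ℕ.* c) ≡ 1ℤ mod d
  sL^c≡1⇒sd^[q*c]≡1 c sL^c≡1 = begin
    Rd.s ^ (q ℕ.* c)  ≡⟨ ℤ.^-*-assoc Rd.s q c ⟨
    (Rd.s ^ q) ^ c    ≈⟨ ^-cong-mod c sL≡sd^q ⟨
    RL.s ^ c          ≈⟨ ≡-mod-∣ d∣L sL^c≡1 ⟩
    1ℤ                ∎

lcm-rank : Rank K m → Rank K n → Rank K (lcm m n)
lcm-rank {K} {m} rm rn =
  rank-from-zero (ℕ.*-mono-< Rm.0<α Rn.0<α) (∣-lcm m∣F[αm*αn] (Rn.m∣F[k*α] Rm.α))
  where
  module Rm = RankProperties rm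
  module Rn = RankProperties rn
  m∣F[αm*αn] : + m ∣ F K (Rm.α ℕ.* Rn.α)
  m∣F[αm*αn] = subst (λ j → + m ∣ F K j) (ℕ.*-comm Rn.α Rm.α) (Rm.m∣F[k*α] Rn.α)

module LcmRank {K : ℤ} {m n : ℕ} (rm : Rank K m) (rn : Rank K n) where
  private
    rL : Rank K (lcm m n)
    rL = lcm-rank rm rn
    module Rm = RankProperties rm
    module Rn = RankProperties rn
    module M  = RankOfMultiple rm rL (m∣lcm[m,n] m n)
    module N  = RankOfMultiple rn rL (n∣lcm[m,n] m n)
  open RankProperties rL

  qm*αm≡qn*αn : M.q ℕ.* Rm.α ≡ N.q ℕ.* Rn.α
  qm*αm≡qn*αn = trans (sym M.αL≡q*αd) N.αL≡q*αd

  -- Otherwise α(L)/2 is a common multiple of α(m) and α(n), hence a smaller zero of F mod L.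
  quotients-not-both-even : 2 ∣ℕ M.q → 2 ∣ℕ N.q → ⊥
  quotients-not-both-even (ℕ.divides a qm≡a*2) (ℕ.divides b qn≡b*2) =
    ℕ.<⇒≱ j<α (α-least 0<j L∣Fⱼ)
    where
    reorder : ∀ a x → a ℕ.* 2 ℕ.* x ≡ a ℕ.* x ℕ.* 2
    reorder = ℕ-Ring.solve-∀
    j : ℕ
    j = a ℕ.* Rm.α
    α≡j*2 : α ≡ j ℕ.* 2
    α≡j*2 = trans M.αL≡q*αd (trans (cong (ℕ._* Rm.α) qm≡a*2) (reorder a Rm.α))
    j≡b*αn : j ≡ b ℕ.* Rn.α
    j≡b*αn = ℕ.*-cancelʳ-≡ j (b ℕ.* Rn.α) 2
      (trans (sym α≡j*2) (trans N.αL≡q*αd (trans (cong (ℕ._* Rn.α) qn≡b*2) (reorder b Rn.α))))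
    0<j : 0 < j
    0<j = ℕ.n≢0⇒n>0 λ j≡0 → ℕ.<-irrefl (sym (trans α≡j*2 (cong (ℕ._* 2) j≡0))) 0<α
    j<α : j < α
    j<α = subst (j <_) (sym α≡j*2) (ℕ.m<m*n j 2 {{>-nonZero 0<j}} (s≤s (s≤s z≤n)))
    L∣Fⱼ : + lcm m n ∣ F K j
    L∣Fⱼ = ∣-lcm (Rm.m∣F[k*α] a) (subst (λ i → + n ∣ F K i) (sym j≡b*αn) (Rn.m∣F[k*α] b))

  private
    half : ∀ {a} → 4 ∣ℕ a ℕ.* 2 → 2 ∣ℕ a
    half = ℕ.*-cancelʳ-∣ 2

  lcm-order-1-1 : HasOrder K m 1 → HasOrder K n 1 → HasOrder K (lcm m n) 1
  lcm-order-1-1 ωm ωn =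
    isMulOrder⇒hasOrder (isMulOrder-1 (≡-mod-lcm (M.sd≡1⇒sL≡1 sm≡1) (N.sd≡1⇒sL≡1 sn≡1)))
    where
    sm≡1 : Rm.s ≡ 1ℤ mod m
    sm≡1 = isMulOrder[1]⇒≡1 (Rm.hasOrder⇒isMulOrder ωm)
    sn≡1 : Rn.s ≡ 1ℤ mod n
    sn≡1 = isMulOrder[1]⇒≡1 (Rn.hasOrder⇒isMulOrder ωn)

  lcm-order-2 : OddInt K ⊎ OddNat m → OddInt K ⊎ OddNat n → 1 < m →
                HasOrder K m 2 → HasOrder K (lcm m n) 2
  lcm-order-2 parity-m parity-n 1<m ωm =
    isMulOrder⇒hasOrder (isMulOrder-2 s≢1 (2∣α⇒s²≡1 (M.2∣αd⇒2∣αL 2∣αm)))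
    where
    om : IsMulOrder m Rm.s 2
    om = Rm.hasOrder⇒isMulOrder ωm
    2∣αm : 2 ∣ℕ Rm.α
    2∣αm = Rm.order-2⇒2∣α parity-m 1<m om
    s≢1 : ¬ s ≡ 1ℤ mod lcm m n
    s≢1 s≡1 = quotients-not-both-even 2∣qm 2∣qn
      where
      2∣qm : 2 ∣ℕ M.q
      2∣qm = isMulOrder-∣ om (M.sL≡1⇒sd^q≡1 s≡1)
      2∣qn : 2 ∣ℕ N.q
      2∣qn = Rn.s^b≡1⇒2∣b parity-n N.q
        (subst (4 ∣ℕ_) qm*αm≡qn*αn (ℕ.*-pres-∣ 2∣qm 2∣αm)) (N.sL≡1⇒sd^q≡1 s≡1)

  lcm-order-4-4 : HasOrder K m 4 → HasOrder K n 4 → HasOrder K (lcm m n) 4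
  lcm-order-4-4 ωm ωn = isMulOrder⇒hasOrder (isMulOrder-4 s²≢1 s^4≡1)
    where
    s²≢1 : ¬ s ^ 2 ≡ 1ℤ mod lcm m n
    s²≢1 s²≡1 = quotients-not-both-even
      (half (isMulOrder-∣ (Rm.hasOrder⇒isMulOrder ωm) (M.sL^c≡1⇒sd^[q*c]≡1 2 s²≡1)))
      (half (isMulOrder-∣ (Rn.hasOrder⇒isMulOrder ωn) (N.sL^c≡1⇒sd^[q*c]≡1 2 s²≡1)))

  lcm-order-odd-4 : ¬ 2 ∣ℕ Rm.α → HasOrder K n 4 → HasOrder K (lcm m n) 4
  lcm-order-odd-4 2∤αm ωn = isMulOrder⇒hasOrder (isMulOrder-4 s²≢1 s^4≡1)
    where
    s²≢1 : ¬ s ^ 2 ≡ 1ℤ mod lcm m n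
    s²≢1 s²≡1 = quotients-not-both-even 2∣qm 2∣qn
      where
      2∣qn : 2 ∣ℕ N.q
      2∣qn = half (isMulOrder-∣ (Rn.hasOrder⇒isMulOrder ωn) (N.sL^c≡1⇒sd^[q*c]≡1 2 s²≡1))
      2∣qm : 2 ∣ℕ M.q
      2∣qm = 2∣b*n⇒2∣b M.q 2∤αm
        (subst (2 ∣ℕ_) (sym qm*αm≡qn*αn) (ℕ.∣m⇒∣m*n Rn.α 2∣qn))

  lcm-order-1-4 : OddInt K ⊎ OddNat m → 1 < m → HasOrder K m 1 → HasOrder K n 4 →
                  (m ≡ 2 → HasOrder K (lcm m n) 4) × (m ≢ 2 → HasOrder K (lcm m n) 2)
  lcm-order-1-4 parity-m 1<m ωm ωn = (λ m≡2 → lcm-order-odd-4 (2∤αm m≡2) ωn) , order-2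
    where
    sm≡1 : Rm.s ≡ 1ℤ mod m
    sm≡1 = isMulOrder[1]⇒≡1 (Rm.hasOrder⇒isMulOrder ωm)
    on : IsMulOrder n Rn.s 4
    on = Rn.hasOrder⇒isMulOrder ωn
    2∤αm : m ≡ 2 → ¬ 2 ∣ℕ Rm.α
    2∤αm m≡2 = subst (λ a → ¬ 2 ∣ℕ a) (sym (rank-of-2 (m≡2⇒K-odd parity-m m≡2) m≡2 rm))
                     (from-no (2 ℕ.∣? 3))
    s≢1 : ¬ s ≡ 1ℤ mod lcm m n
    s≢1 s≡1 = quotients-not-both-even 2∣qm (ℕ.∣-trans 2∣4 4∣qn)
      where
      4∣qn : 4 ∣ℕ N.q
      4∣qn = isMulOrder-∣ on (N.sL≡1⇒sd^q≡1 s≡1)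
      2∣qm : 2 ∣ℕ M.q
      2∣qm = 4∣b*n⇒2∣b M.q (Rm.s≡1⇒4∤α parity-m sm≡1)
        (subst (4 ∣ℕ_) (sym qm*αm≡qn*αn) (ℕ.∣m⇒∣m*n Rn.α 4∣qn))
    order-2 : m ≢ 2 → HasOrder K (lcm m n) 2
    order-2 m≢2 = isMulOrder⇒hasOrder
      (isMulOrder-2 s≢1 (2∣α⇒s²≡1 (M.2∣αd⇒2∣αL (Rm.s≡1⇒2∣α 1<m m≢2 sm≡1))))

theorem4p27 : (K : ℤ) (m n : ℕ) → 1 < m → 1 < n →
    (OddInt K ⊎ (¬ OddInt K × OddNat m × OddNat n)) →
    ((HasOrder K m 1 → HasOrder K n 1 → HasOrder K (lcm m n) 1)
    × ((HasOrder K m 2 ⊎ HasOrder K n 2) → HasOrder K (lcm m n) 2)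
    × (HasOrder K m 4 → HasOrder K n 4 → HasOrder K (lcm m n) 4)
    × (HasOrder K m 1 → HasOrder K n 4 →
        (m ≡ 2 → HasOrder K (lcm m n) 4) × (m ≢ 2 → HasOrder K (lcm m n) 2))
    × (HasOrder K n 1 → HasOrder K m 4 →
        (n ≡ 2 → HasOrder K (lcm m n) 4) × (n ≢ 2 → HasOrder K (lcm m n) 2)))
theorem4p27 K m n 1<m 1<n parity =
    lcm-order-1-1
  , [ lcm-order-2 parity-m parity-n 1<m , swap ∘ N-M.lcm-order-2 parity-n parity-m 1<n ]′
  , lcm-order-4-4
  , lcm-order-1-4 parity-m 1<m
  , λ ωn ωm → Product.map (swap ∘_) (swap ∘_) (N-M.lcm-order-1-4 parity-n 1<n ωn ωm)
  where
  rm : Rank K m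
  rm = rank K m {{>-nonZero (ℕ.<⇒≤ 1<m)}}
  rn : Rank K n
  rn = rank K n {{>-nonZero (ℕ.<⇒≤ 1<n)}}
  open LcmRank rm rn
  module N-M = LcmRank rn rm
  parity-m : OddInt K ⊎ OddNat m
  parity-m = map₂ (proj₁ ∘ proj₂) parity
  parity-n : OddInt K ⊎ OddNat n
  parity-n = map₂ (proj₂ ∘ proj₂) parity
  swap : ∀ {k} → HasOrder K (lcm n m) k → HasOrder K (lcm m n) k
  swap = subst (λ L → HasOrder K L _) (lcm-comm n m)
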